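{- If $n$ is a positive integer with $\omega(M_n)=2$, then $n=4$, or $n=6$, or $n=p_1$, or $n=p_1^2$ for some odd prime $p_1$. Furthermore, for such $n$: (i) if $n=p_1^2$ with $p_1$ an odd prime, then $M_n=M_{p_1}q^t$ for some prime $q$ and some positive integer $t$; (ii) if $n=p_1$ with $p_1$ an odd prime, then $M_n=p^sq^t$ where $p,q$ are distinct odd primes and $s,t$ are positive integers with $\gcd(s,t)=1$; moreover $p=2l_1p_1+1$ and $q=2l_2p_1+1$, where $l_1,l_2$ are distinct positive integers with $l_i\equiv 0$ or $l_i\equiv -p_1 \pmod 4$ for $i=1,2$.
   Context: For an integer $n\ge 0$, $M_n=2^n-1$ denotes the $n$-th Mersenne number. For a positive integer $m$, $\omega(m)$ denotes the number of distinct prime divisors of $m$. -}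

module Defs where

open import Data.Nat using (ℕ; suc; _∸_; _^_)
open import Data.Nat.Divisibility using (_∣?_)
open import Data.Nat.Primality using (prime?)
open import Data.List using (List; length; filter; upTo; map)

M : ℕ → ℕ
M n = 2 ^ n ∸ 1

primeDivisors : ℕ → List ℕ
primeDivisors m = filter prime? (filter (_∣? m) (map suc (upTo m)))

-- ω(m) = number of distinct prime divisors of m (intended for m ≥ 1)
ω : ℕ → ℕ
ω m = length (primeDivisors m)

-- For d ∣ n, M d ∣ M n, so n has no divisor d for which M d has three distinct prime factors:
-- not 8, 12 or 18; not p³ for odd p, since M p, M (p²) / M p and M (p³) / M (p²) are pairwise
-- coprime; and not pq for primes p ≠ q, q ≥ 5: there M (pq) = M p · M q · C where C divides
-- both M (pq) / M p and M (pq) / M q, and lifting the exponent bounds C by pq, which is too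
-- small. This leaves n ∈ {4, 6, p, p²}. For n = p², M (p²) / M p is coprime to M p and hence
-- a prime power. For n = p, a prime divisor r of M p is 2lp + 1 by Fermat, and r ≡ ±1 (mod 8)
-- because 2 is a square mod r; finally gcd s t = 1 because M p ≡ 3 (mod 4) is no perfect power.

module Submission where

open import Defs
open import Data.Nat hiding (parity)
open import Data.Nat.Properties
open import Data.Nat.Divisibility
open import Data.Nat.DivMod
open import Data.Nat.GCD
open import Data.Nat.Coprimality using (Coprime; coprime-divisor)
open import Data.Nat.Primality
open import Data.Nat.Primality.Factorisation using (factorise)
open import Data.Nat.ListAction using (product)
open import Data.Nat.Induction using (<-rec)
open import Data.Nat.Tactic.RingSolver using (solve-∀)
open import Data.List using (List; []; _∷_; length; map; upTo)
open import Data.List.Membership.Propositional using (_∈_)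
open import Data.List.Membership.Propositional.Properties using (∈-filter⁺; ∈-filter⁻; ∈-map⁺; ∈-upTo⁺)
open import Data.List.Relation.Unary.Any using (here; there)
open import Data.List.Relation.Unary.All using ([]; _∷_)
open import Data.List.Relation.Unary.AllPairs using (_∷_)
open import Data.List.Relation.Unary.Unique.Propositional using (Unique)
open import Data.List.Relation.Unary.Unique.Propositional.Properties using (filter⁺; map⁺; upTo⁺)
open import Data.Integer as ℤ using (ℤ; +_; 1ℤ; -1ℤ; ∣_∣)
import Data.Integer.Properties as ℤ
import Data.Integer.Divisibility.Signed as ℤ∣
open ℤ∣ using () renaming (_∣_ to _∣ℤ_)
import Data.Integer.Tactic.RingSolver as ℤ-Solver
open import Data.Product using (∃-syntax; _×_; _,_; proj₁; proj₂)
open import Data.Sum using (_⊎_; inj₁; inj₂)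
open import Data.Empty using (⊥; ⊥-elim)
open import Relation.Nullary using (¬_; yes; no)
open import Relation.Nullary.Decidable using (from-yes)
open import Relation.Binary.PropositionalEquality

prime≥2 : ∀ {p} → Prime p → 2 ≤ p
prime≥2 {p} pp = nonTrivial⇒n>1 p {{prime⇒nonTrivial pp}}

prime≢1 : ∀ {p} → Prime p → p ≢ 1
prime≢1 pp refl with prime≥2 pp
... | s≤s ()

prime∣prime⇒≡ : ∀ {r p} → Prime r → Prime p → r ∣ p → r ≡ p
prime∣prime⇒≡ pr pp r∣p with prime⇒irreducible pp r∣p
... | inj₁ r≡1 = ⊥-elim (prime≢1 pr r≡1)
... | inj₂ r≡p = r≡p

prime∣^⇒prime∣ : ∀ {r x} n → Prime r → r ∣ x ^ n → r ∣ x
prime∣^⇒prime∣ zero pr r∣1 = ⊥-elim (prime≢1 pr (∣1⇒≡1 r∣1))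
prime∣^⇒prime∣ {x = x} (suc n) pr r∣x^n with euclidsLemma x (x ^ n) pr r∣x^n
... | inj₁ r∣x = r∣x
... | inj₂ r∣x^n = prime∣^⇒prime∣ n pr r∣x^n

∃primeFactor : ∀ {m} → 2 ≤ m → ∃[ r ] (Prime r × r ∣ m)
∃primeFactor {1} (s≤s ())
∃primeFactor {m@(suc (suc _))} _ with factorise m
... | record { factors = r ∷ rs ; isFactorisation = m≡ ; factorsPrime = pr ∷ _ } =
  r , pr , subst (r ∣_) (sym m≡) (m∣m*n (product rs))

parity : ∀ n → ∃[ k ] (n ≡ k + k) ⊎ ∃[ k ] (n ≡ suc (k + k))
parity zero = inj₁ (0 , refl)
parity (suc n) with parity n
... | inj₁ (k , n≡) = inj₂ (k , cong suc n≡)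
... | inj₂ (k , n≡) = inj₁ (suc k , cong suc (trans n≡ (sym (+-suc k k))))

oddPrime⇒≡2h+1 : ∀ {r} → Prime r → r ≢ 2 → ∃[ h ] (r ≡ suc (2 * h))
oddPrime⇒≡2h+1 {r} pr r≢2 with parity r
... | inj₁ (k , refl) = ⊥-elim (r≢2 (sym (prime∣prime⇒≡ prime[2] pr (divides k (k+k≡k*2 k)))))
  where
  k+k≡k*2 : ∀ k → k + k ≡ k * 2
  k+k≡k*2 = solve-∀
... | inj₂ (k , refl) = k , cong suc (k+k≡2*k k)
  where
  k+k≡2*k : ∀ k → k + k ≡ 2 * k
  k+k≡2*k = solve-∀

prime≥5 : ∀ {r} → Prime r → r ≢ 2 → r ≢ 3 → 5 ≤ r
prime≥5 {r} pr r≢2 r≢3 = go r (prime≥2 pr) pr r≢2 r≢3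
  where
  go : ∀ r → 2 ≤ r → Prime r → r ≢ 2 → r ≢ 3 → 5 ≤ r
  go 1 (s≤s ()) _ _ _
  go 2 _ _ r≢2 _ = ⊥-elim (r≢2 refl)
  go 3 _ _ _ r≢3 = ⊥-elim (r≢3 refl)
  go 4 _ pr _ _ with prime∣prime⇒≡ prime[2] pr (divides 2 refl)
  ... | ()
  go (suc (suc (suc (suc (suc _))))) _ _ _ _ = s≤s (s≤s (s≤s (s≤s (s≤s z≤n))))

geom : ℕ → ℕ → ℕ
geom z zero = 0
geom z (suc k) = geom z k + z ^ k

triangular : ℕ → ℕ
triangular zero = 0
triangular (suc k) = triangular k + k

suc-M : ∀ n → suc (M n) ≡ 2 ^ n
suc-M n = trans (+-comm 1 (2 ^ n ∸ 1)) (m∸n+n≡m (m^n>0 2 n))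

geom-sum : ∀ w k → w * geom (suc w) k + 1 ≡ suc w ^ k
geom-sum w zero = cong (_+ 1) (*-zeroʳ w)
geom-sum w (suc k) = begin
    w * (geom (suc w) k + suc w ^ k) + 1
  ≡⟨ rearrange w (geom (suc w) k) (suc w ^ k) ⟩
    (w * geom (suc w) k + 1) + w * suc w ^ k
  ≡⟨ cong (_+ w * suc w ^ k) (geom-sum w k) ⟩
    suc w ^ k + w * suc w ^ k
  ∎
  where
  open ≡-Reasoning
  rearrange : ∀ w g z → w * (g + z) + 1 ≡ (w * g + 1) + w * z
  rearrange = solve-∀

M-* : ∀ a k → M (a * k) ≡ M a * geom (2 ^ a) k
M-* a k = suc-injective (begin
    suc (M (a * k))                ≡⟨ suc-M (a * k) ⟩
    2 ^ (a * k)                    ≡⟨ ^-*-assoc 2 a k ⟨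
    (2 ^ a) ^ k                    ≡⟨ cong (_^ k) (suc-M a) ⟨
    suc (M a) ^ k                  ≡⟨ geom-sum (M a) k ⟨
    M a * geom (suc (M a)) k + 1   ≡⟨ +-comm _ 1 ⟩
    suc (M a * geom (suc (M a)) k) ≡⟨ cong (λ z → suc (M a * geom z k)) (suc-M a) ⟩
    suc (M a * geom (2 ^ a) k)     ∎)
  where open ≡-Reasoning

M-+ : ∀ a b → M (a + b) ≡ M a + 2 ^ a * M b
M-+ a b = suc-injective (begin
    suc (M (a + b))              ≡⟨ suc-M (a + b) ⟩
    2 ^ (a + b)                  ≡⟨ ^-distribˡ-+-* 2 a b ⟩
    2 ^ a * 2 ^ b                ≡⟨ cong₂ _*_ (suc-M a) (suc-M b) ⟨
    suc (M a) * suc (M b)        ≡⟨ expand (M a) (M b) ⟩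
    suc (M a + suc (M a) * M b)  ≡⟨ cong (λ z → suc (M a + z * M b)) (suc-M a) ⟩
    suc (M a + 2 ^ a * M b)      ∎)
  where
  open ≡-Reasoning
  expand : ∀ x y → suc x * suc y ≡ suc (x + suc x * y)
  expand = solve-∀

M-mono-∣ : ∀ {d n} → d ∣ n → M d ∣ M n
M-mono-∣ {d} (divides k refl) =
  subst (λ z → M d ∣ M z) (*-comm d k) (divides (geom (2 ^ d) k) (trans (M-* d k) (*-comm (M d) _)))

-- Bézout: if g + y b = x a then M (x a) = M g + 2^g M (y b), and M a, M b divide M (x a), M (y b).
∣M-gcd : ∀ {r a b} → r ∣ M a → r ∣ M b → r ∣ M (gcd a b)
∣M-gcd {r} {a} {b} r∣Ma r∣Mb = fromBézout (Bézout.identity (gcd-GCD a b))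
  where
  r∣M[_*a] : ∀ x → r ∣ M (x * a)
  r∣M[ x *a] = ∣-trans r∣Ma (M-mono-∣ {a} (n∣m*n x))
  r∣M[_*b] : ∀ y → r ∣ M (y * b)
  r∣M[ y *b] = ∣-trans r∣Mb (M-mono-∣ {b} (n∣m*n y))
  cancel : ∀ g u {v} → g + u ≡ v → r ∣ M u → r ∣ M v → r ∣ M g
  cancel g u refl r∣Mu r∣Mv =
    ∣m+n∣m⇒∣n (subst (r ∣_) (trans (M-+ g u) (+-comm (M g) _)) r∣Mv) (∣n⇒∣m*n (2 ^ g) r∣Mu)
  fromBézout : ∀ {g} → Bézout.Identity g a b → r ∣ M g
  fromBézout {g} (Bézout.+- x y eq) = cancel g (y * b) eq r∣M[ y *b] r∣M[ x *a]
  fromBézout {g} (Bézout.-+ x y eq) = cancel g (x * a) eq r∣M[ x *a] r∣M[ y *b]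

M-coprime : ∀ {p q} → gcd p q ≡ 1 → Coprime (M p) (M q)
M-coprime {p} {q} gcd≡1 (r∣Mp , r∣Mq) =
  ∣1⇒≡1 (subst (λ z → _ ∣ M z) gcd≡1 (∣M-gcd {a = p} {b = q} r∣Mp r∣Mq))

M-odd : ∀ {n} → 1 ≤ n → ¬ 2 ∣ M n
M-odd {suc n} _ 2∣M = 2≢1 (∣1⇒≡1 (∣m+n∣m⇒∣n 2∣M+1 2∣M))
  where
  2≢1 : 2 ≢ 1
  2≢1 ()
  2∣M+1 : 2 ∣ M (suc n) + 1
  2∣M+1 = subst (2 ∣_) (trans (sym (suc-M (suc n))) (+-comm 1 _)) (m∣m*n (2 ^ n))

M[2+n]≡3+M[n]*4 : ∀ n → M (2 + n) ≡ 3 + M n * 4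
M[2+n]≡3+M[n]*4 n = suc-injective (begin
    suc (M (2 + n))      ≡⟨ suc-M (2 + n) ⟩
    2 * (2 * 2 ^ n)      ≡⟨ cong (λ z → 2 * (2 * z)) (suc-M n) ⟨
    2 * (2 * suc (M n))  ≡⟨ expand (M n) ⟩
    suc (3 + M n * 4)    ∎)
  where
  open ≡-Reasoning
  expand : ∀ m → 2 * (2 * suc m) ≡ suc (3 + m * 4)
  expand = solve-∀

M≥1 : ∀ {n} → 1 ≤ n → 1 ≤ M n
M≥1 {suc n} _ = subst (1 ≤_) (sym (M-+ 1 n)) (s≤s z≤n)

M≥3 : ∀ {n} → 2 ≤ n → 3 ≤ M n
M≥3 {1} (s≤s ())
M≥3 {suc (suc n)} _ = subst (3 ≤_) (sym (M[2+n]≡3+M[n]*4 n)) (m≤m+n 3 _)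

∃prime∣M : ∀ {n} → 2 ≤ n → ∃[ r ] (Prime r × r ∣ M n)
∃prime∣M 2≤n = ∃primeFactor (≤-trans (n≤1+n 2) (M≥3 2≤n))

∣M⇒≢2 : ∀ {r n} → 1 ≤ n → r ∣ M n → r ≢ 2
∣M⇒≢2 1≤n r∣M refl = M-odd 1≤n r∣M

suc-^-expansion : ∀ w i → ∃[ E ] (suc w ^ i ≡ 1 + i * w + w * w * E)
suc-^-expansion w zero = 0 , base w
  where
  base : ∀ w → 1 ≡ 1 + 0 * w + w * w * 0
  base = solve-∀
suc-^-expansion w (suc i) with suc-^-expansion w i
... | E , eq = E + i + w * E , (begin
    suc w * suc w ^ i                     ≡⟨ cong (suc w *_) eq ⟩
    suc w * (1 + i * w + w * w * E)       ≡⟨ step w i E ⟩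
    1 + suc i * w + w * w * (E + i + w * E) ∎)
  where
  open ≡-Reasoning
  step : ∀ w i E → suc w * (1 + i * w + w * w * E) ≡ 1 + suc i * w + w * w * (E + i + w * E)
  step = solve-∀

geom-expansion : ∀ w k → ∃[ E ] (geom (suc w) k ≡ k + w * triangular k + w * w * E)
geom-expansion w zero = 0 , base w
  where
  base : ∀ w → 0 ≡ 0 + w * 0 + w * w * 0
  base = solve-∀
geom-expansion w (suc k) with geom-expansion w k | suc-^-expansion w k
... | E , eq | F , eq′ = E + F , (begin
    geom (suc w) k + suc w ^ k
  ≡⟨ cong₂ _+_ eq eq′ ⟩
    (k + w * triangular k + w * w * E) + (1 + k * w + w * w * F)
  ≡⟨ step w k (triangular k) E F ⟩
    suc k + w * (triangular k + k) + w * w * (E + F)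
  ∎)
  where
  open ≡-Reasoning
  step : ∀ w k t E F → (k + w * t + w * w * E) + (1 + k * w + w * w * F) ≡ suc k + w * (t + k) + w * w * (E + F)
  step = solve-∀

geom-2^-expansion : ∀ a k → ∃[ E ] (geom (2 ^ a) k ≡ k + (M a * triangular k + M a * M a * E))
geom-2^-expansion a k with geom-expansion (M a) k
... | E , eq = E , trans (cong (λ z → geom z k) (sym (suc-M a))) (trans eq (+-assoc k _ _))

∣M∧∣geom⇒∣ : ∀ {r a} k → r ∣ M a → r ∣ geom (2 ^ a) k → r ∣ k
∣M∧∣geom⇒∣ {r} {a} k r∣Ma r∣geom with geom-2^-expansion a k
... | E , eq = ∣m+n∣m⇒∣n (subst (r ∣_) (trans eq (+-comm k _)) r∣geom)
                         (∣m∣n⇒∣m+n (∣m⇒∣m*n (triangular k) r∣Ma) (∣m⇒∣m*n E (∣m⇒∣m*n (M a) r∣Ma)))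

2*triangular+k≡k*k : ∀ k → 2 * triangular k + k ≡ k * k
2*triangular+k≡k*k zero = refl
2*triangular+k≡k*k (suc k) = begin
    2 * (triangular k + k) + suc k       ≡⟨ regroup (triangular k) k ⟩
    2 * triangular k + k + suc (k + k)   ≡⟨ cong (_+ suc (k + k)) (2*triangular+k≡k*k k) ⟩
    k * k + suc (k + k)                  ≡⟨ square k ⟩
    suc k * suc k                        ∎
  where
  open ≡-Reasoning
  regroup : ∀ t k → 2 * (t + k) + suc k ≡ 2 * t + k + suc (k + k)
  regroup = solve-∀
  square : ∀ k → k * k + suc (k + k) ≡ suc k * suc k
  square = solve-∀

triangular-odd : ∀ h → triangular (suc (2 * h)) ≡ suc (2 * h) * h
triangular-odd h = *-cancelˡ-≡ _ _ 2 (+-cancelʳ-≡ (suc (2 * h)) _ _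
  (trans (2*triangular+k≡k*k (suc (2 * h))) (square h)))
  where
  square : ∀ h → suc (2 * h) * suc (2 * h) ≡ 2 * (suc (2 * h) * h) + suc (2 * h)
  square = solve-∀

-- The lifting-the-exponent step: modulo q², geom (2^a) q ≡ q + M a · q(q-1)/2 ≡ q.
sq∤geom : ∀ {q a} → Prime q → q ≢ 2 → q ∣ M a → ¬ (q * q ∣ geom (2 ^ a) q)
sq∤geom {q} {a} pq q≢2 q∣Ma q²∣geom with oddPrime⇒≡2h+1 pq q≢2 | q∣Ma
... | h , refl | divides c Ma≡ with geom-2^-expansion a q
...   | E , geom≡ = <⇒≱ q<q² (∣⇒≤ (∣m+n∣m⇒∣n q²∣q+X q²∣X))
  where
  X : ℕ
  X = M a * triangular q + M a * M a * E
  q²∣q+X : q * q ∣ X + q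
  q²∣q+X = subst (q * q ∣_) (trans geom≡ (+-comm q X)) q²∣geom
  q²∣X : q * q ∣ X
  q²∣X = ∣m∣n⇒∣m+n
    (divides (c * h) (trans (cong₂ _*_ Ma≡ (triangular-odd h)) (regroup₁ c q h)))
    (divides (c * c * E) (trans (cong (λ z → z * z * E) Ma≡) (regroup₂ c q E)))
    where
    regroup₁ : ∀ c q h → c * q * (q * h) ≡ c * h * (q * q)
    regroup₁ = solve-∀
    regroup₂ : ∀ c q E → c * q * (c * q) * E ≡ c * c * E * (q * q)
    regroup₂ = solve-∀
  q<q² : q < q * q
  q<q² = m<m*n q q (prime≥2 pq)

-- Gauss's lemma for the residue symbol (2/r), r = 2h + 1: with b = ⌈h/2⌉,
-- 2^h h! = 2·4⋯2h ≡ (-1)^b h! (mod r), because 2(h - i) ≡ -(2i + 1).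

evens : ℕ → ℕ
evens zero = 1
evens (suc k) = evens k * (2 * suc k)

odds : ℕ → ℕ
odds zero = 1
odds (suc k) = odds k * suc (2 * k)

topEvens : ℕ → ℕ → ℕ
topEvens N zero = 1
topEvens N (suc b) = topEvens N b * (2 * (N ∸ b))

sign : ℕ → ℤ
sign zero = 1ℤ
sign (suc b) = ℤ.- sign b

sign-even : ∀ j → sign (j + j) ≡ 1ℤ
sign-odd : ∀ j → sign (suc (j + j)) ≡ -1ℤ
sign-even zero = refl
sign-even (suc j) = trans (cong (λ z → ℤ.- sign z) (+-suc j j)) (cong ℤ.-_ (sign-odd j))
sign-odd j = cong ℤ.-_ (sign-even j)

evens≡2^*! : ∀ k → evens k ≡ 2 ^ k * k !
evens≡2^*! zero = refl
evens≡2^*! (suc k) = trans (cong (_* (2 * suc k)) (evens≡2^*! k)) (regroup (2 ^ k) (k !) k)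
  where
  regroup : ∀ a f k → a * f * (2 * suc k) ≡ 2 * a * (f + k * f)
  regroup = solve-∀

!≡evens*odds : ∀ k → (k + k) ! ≡ evens k * odds k × (suc (k + k)) ! ≡ evens k * odds (suc k)
!≡evens*odds zero = refl , refl
!≡evens*odds (suc k) with !≡evens*odds k
... | even! , odd! = even!′ , odd!′
  where
  open ≡-Reasoning
  even!′ : (suc k + suc k) ! ≡ evens (suc k) * odds (suc k)
  even!′ = begin
      (suc k + suc k) !                         ≡⟨ cong _! (cong suc (+-suc k k)) ⟩
      suc (suc (k + k)) * (suc (k + k)) !       ≡⟨ cong (suc (suc (k + k)) *_) odd! ⟩
      suc (suc (k + k)) * (evens k * odds (suc k)) ≡⟨ regroup k (evens k) (odds (suc k)) ⟩
      evens k * (2 * suc k) * odds (suc k)      ∎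
    where
    regroup : ∀ k e o → suc (suc (k + k)) * (e * o) ≡ e * (2 * suc k) * o
    regroup = solve-∀
  odd!′ : (suc (suc k + suc k)) ! ≡ evens (suc k) * odds (suc (suc k))
  odd!′ = begin
      suc (suc k + suc k) * (suc k + suc k) !                 ≡⟨ cong (suc (suc k + suc k) *_) even!′ ⟩
      suc (suc k + suc k) * (evens (suc k) * odds (suc k))    ≡⟨ regroup k (evens (suc k)) (odds (suc k)) ⟩
      evens (suc k) * (odds (suc k) * suc (2 * suc k))        ∎
    where
    regroup : ∀ k e o → suc (suc k + suc k) * (e * o) ≡ e * (o * suc (2 * suc k))
    regroup = solve-∀

evens-split : ∀ c b → evens (c + b) ≡ evens c * topEvens (c + b) b
evens-split c zero = trans (cong evens (+-identityʳ c)) (sym (*-identityʳ (evens c)))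
evens-split c (suc b) = begin
    evens (c + suc b)
  ≡⟨ cong evens (+-suc c b) ⟩
    evens (suc c + b)
  ≡⟨ evens-split (suc c) b ⟩
    evens c * (2 * suc c) * topEvens (suc c + b) b
  ≡⟨ cong (λ z → evens c * (2 * z) * topEvens (suc c + b) b) (m+n∸n≡m (suc c) b) ⟨
    evens c * (2 * (suc c + b ∸ b)) * topEvens (suc c + b) b
  ≡⟨ *-assoc (evens c) _ _ ⟩
    evens c * (2 * (suc c + b ∸ b) * topEvens (suc c + b) b)
  ≡⟨ cong (evens c *_) (*-comm (2 * (suc c + b ∸ b)) _) ⟩
    evens c * (topEvens (suc c + b) b * (2 * (suc c + b ∸ b)))
  ≡⟨ cong (λ z → evens c * (topEvens z b * (2 * (z ∸ b)))) (+-suc c b) ⟨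
    evens c * (topEvens (c + suc b) b * (2 * (c + suc b ∸ b)))
  ∎
  where open ≡-Reasoning

topEvens≡sign*odds : ∀ c b → (+ suc (2 * (c + b))) ∣ℤ (+ topEvens (c + b) b ℤ.- sign b ℤ.* + odds b)
topEvens≡sign*odds c zero = ℤ∣.divides (+ 0) refl
topEvens≡sign*odds c (suc b) = subst ((+ suc (2 * N)) ∣ℤ_) (sym step)
  (ℤ∣.∣m∣n⇒∣m+n (ℤ∣.∣m⇒∣m*n (+ x) ih)
                 (ℤ∣.∣n⇒∣m*n (sign b ℤ.* + odds b) (ℤ∣.∣-reflexive (sym x+y≡r))))
  where
  N x y : ℕ
  N = c + suc b
  x = 2 * (N ∸ b)
  y = suc (2 * b)
  N≡ : suc c + b ≡ N
  N≡ = sym (+-suc c b)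
  ih : (+ suc (2 * N)) ∣ℤ (+ topEvens N b ℤ.- sign b ℤ.* + odds b)
  ih = subst (λ z → (+ suc (2 * z)) ∣ℤ (+ topEvens z b ℤ.- sign b ℤ.* + odds b)) N≡
             (topEvens≡sign*odds (suc c) b)
  x+y≡r : + x ℤ.+ + y ≡ + suc (2 * N)
  x+y≡r = trans (sym (ℤ.pos-+ x y)) (cong +_ (begin
      2 * (N ∸ b) + suc (2 * b)          ≡⟨ cong (λ z → 2 * (z ∸ b) + suc (2 * b)) N≡ ⟨
      2 * (suc c + b ∸ b) + suc (2 * b)  ≡⟨ cong (λ z → 2 * z + suc (2 * b)) (m+n∸n≡m (suc c) b) ⟩
      2 * suc c + suc (2 * b)            ≡⟨ regroup c b ⟩
      suc (2 * N)                        ∎))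
    where
    open ≡-Reasoning
    regroup : ∀ c b → 2 * suc c + suc (2 * b) ≡ suc (2 * (c + suc b))
    regroup = solve-∀
  step : + (topEvens N b * x) ℤ.- ℤ.- sign b ℤ.* + (odds b * y)
       ≡ (+ topEvens N b ℤ.- sign b ℤ.* + odds b) ℤ.* + x ℤ.+ sign b ℤ.* + odds b ℤ.* (+ x ℤ.+ + y)
  step = begin
      + (topEvens N b * x) ℤ.- ℤ.- sign b ℤ.* + (odds b * y)
    ≡⟨ cong₂ (λ u v → u ℤ.- ℤ.- sign b ℤ.* v) (ℤ.pos-* (topEvens N b) x) (ℤ.pos-* (odds b) y) ⟩
      + topEvens N b ℤ.* + x ℤ.- ℤ.- sign b ℤ.* (+ odds b ℤ.* + y)
    ≡⟨ regroup (+ topEvens N b) (+ x) (sign b) (+ odds b) (+ y) ⟩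
      (+ topEvens N b ℤ.- sign b ℤ.* + odds b) ℤ.* + x ℤ.+ sign b ℤ.* + odds b ℤ.* (+ x ℤ.+ + y)
    ∎
    where
    open ≡-Reasoning
    regroup : ∀ t x s o y → t ℤ.* x ℤ.- ℤ.- s ℤ.* (o ℤ.* y) ≡ (t ℤ.- s ℤ.* o) ℤ.* x ℤ.+ s ℤ.* o ℤ.* (x ℤ.+ y)
    regroup = ℤ-Solver.solve-∀

prime∤! : ∀ {r} → Prime r → ∀ h → h < r → ¬ r ∣ h !
prime∤! pr zero _ r∣1 = prime≢1 pr (∣1⇒≡1 r∣1)
prime∤! pr (suc h) h<r r∣h! with euclidsLemma (suc h) (h !) pr r∣h!
... | inj₁ r∣h = <⇒≱ h<r (∣⇒≤ r∣h)
... | inj₂ r∣h! = prime∤! pr h (<-trans (n<1+n h) h<r) r∣h!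

gauss-core : ∀ {h} c b → c + b ≡ h → evens c * odds b ≡ h ! → Prime (suc (2 * h)) →
             suc (2 * h) ∣ ∣ + 2 ^ h ℤ.- sign b ∣
gauss-core c b refl e*o≡! pr with euclidsLemma ∣ + 2 ^ (c + b) ℤ.- sign b ∣ ((c + b) !) pr r∣[2^h-sign]*h!
  where
  h : ℕ
  h = c + b
  factor : + evens c ℤ.* (+ topEvens h b ℤ.- sign b ℤ.* + odds b) ≡ (+ 2 ^ h ℤ.- sign b) ℤ.* + (h !)
  factor = begin
      + evens c ℤ.* (+ topEvens h b ℤ.- sign b ℤ.* + odds b)
    ≡⟨ distrib (+ evens c) (+ topEvens h b) (sign b) (+ odds b) ⟩
      + evens c ℤ.* + topEvens h b ℤ.- sign b ℤ.* (+ evens c ℤ.* + odds b)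
    ≡⟨ cong₂ (λ u v → u ℤ.- sign b ℤ.* v) (ℤ.pos-* (evens c) (topEvens h b)) (ℤ.pos-* (evens c) (odds b)) ⟨
      + (evens c * topEvens h b) ℤ.- sign b ℤ.* + (evens c * odds b)
    ≡⟨ cong₂ (λ u v → + u ℤ.- sign b ℤ.* + v) (trans (sym (evens-split c b)) (evens≡2^*! h)) e*o≡! ⟩
      + (2 ^ h * h !) ℤ.- sign b ℤ.* + (h !)
    ≡⟨ cong (λ u → u ℤ.- sign b ℤ.* + (h !)) (ℤ.pos-* (2 ^ h) (h !)) ⟩
      + 2 ^ h ℤ.* + (h !) ℤ.- sign b ℤ.* + (h !)
    ≡⟨ collect (+ 2 ^ h) (sign b) (+ (h !)) ⟩
      (+ 2 ^ h ℤ.- sign b) ℤ.* + (h !)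
    ∎
    where
    open ≡-Reasoning
    distrib : ∀ e t s o → e ℤ.* (t ℤ.- s ℤ.* o) ≡ e ℤ.* t ℤ.- s ℤ.* (e ℤ.* o)
    distrib = ℤ-Solver.solve-∀
    collect : ∀ t s f → t ℤ.* f ℤ.- s ℤ.* f ≡ (t ℤ.- s) ℤ.* f
    collect = ℤ-Solver.solve-∀
  r∣[2^h-sign]*h! : suc (2 * h) ∣ ∣ + 2 ^ h ℤ.- sign b ∣ * h !
  r∣[2^h-sign]*h! = subst (suc (2 * h) ∣_) (ℤ.abs-* (+ 2 ^ h ℤ.- sign b) (+ (h !)))
    (ℤ∣.∣⇒∣ᵤ (subst ((+ suc (2 * h)) ∣ℤ_) factor (ℤ∣.∣n⇒∣m*n (+ evens c) (topEvens≡sign*odds c b))))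
... | inj₁ r∣2^h-sign = r∣2^h-sign
... | inj₂ r∣h! = ⊥-elim (prime∤! pr (c + b) (s≤s (m≤m+n (c + b) _)) r∣h!)

gauss-even : ∀ k → Prime (suc (2 * (k + k))) → suc (2 * (k + k)) ∣ ∣ + 2 ^ (k + k) ℤ.- sign k ∣
gauss-even k = gauss-core k k refl (sym (proj₁ (!≡evens*odds k)))

gauss-odd : ∀ k → Prime (suc (2 * suc (k + k))) →
            suc (2 * suc (k + k)) ∣ ∣ + 2 ^ suc (k + k) ℤ.- sign (suc k) ∣
gauss-odd k = gauss-core k (suc k) (+-suc k k) (sym (proj₂ (!≡evens*odds k)))

sign≡1⇒∣M : ∀ {r} h b → sign b ≡ 1ℤ → r ∣ ∣ + 2 ^ h ℤ.- sign b ∣ → r ∣ M h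
sign≡1⇒∣M {r} h b sign≡1 r∣ =
  subst (r ∣_) (cong ∣_∣ |2^h-1|) (subst (λ s → r ∣ ∣ + 2 ^ h ℤ.- s ∣) sign≡1 r∣)
  where
  |2^h-1| : + 2 ^ h ℤ.- 1ℤ ≡ + M h
  |2^h-1| = trans (ℤ.m-n≡m⊖n (2 ^ h) 1) (ℤ.⊖-≥ (m^n>0 2 h))

sign≡-1⇒∣2^+1 : ∀ {r} h b → sign b ≡ -1ℤ → r ∣ ∣ + 2 ^ h ℤ.- sign b ∣ → r ∣ 2 ^ h + 1
sign≡-1⇒∣2^+1 {r} h b sign≡-1 r∣ =
  subst (r ∣_) (cong ∣_∣ (sym (ℤ.pos-+ (2 ^ h) 1))) (subst (λ s → r ∣ ∣ + 2 ^ h ℤ.- s ∣) sign≡-1 r∣)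

-- The second supplementary law: 2 is a square modulo r = 2h + 1 iff r ≡ ±1 (mod 8).
gauss-2 : ∀ h → Prime (suc (2 * h)) →
          (suc (2 * h) ∣ M h × (h % 4 ≡ 0 ⊎ h % 4 ≡ 3)) ⊎ suc (2 * h) ∣ 2 ^ h + 1
gauss-2 h pr with parity h
... | inj₁ (k , refl) with parity k
...   | inj₁ (j , refl) = inj₁ (sign≡1⇒∣M (k + k) k (sign-even j) (gauss-even k pr) , inj₁ h%4≡0)
  where
  h≡j*4 : ∀ j → (j + j) + (j + j) ≡ j * 4
  h≡j*4 = solve-∀
  h%4≡0 : ((j + j) + (j + j)) % 4 ≡ 0
  h%4≡0 = trans (cong (_% 4) (h≡j*4 j)) (m*n%n≡0 j 4)
...   | inj₂ (j , refl) = inj₂ (sign≡-1⇒∣2^+1 (k + k) k (sign-odd j) (gauss-even k pr))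
gauss-2 h pr | inj₂ (k , refl) with parity k
...   | inj₁ (j , refl) = inj₂ (sign≡-1⇒∣2^+1 (suc (k + k)) (suc k) (sign-odd j) (gauss-odd k pr))
...   | inj₂ (j , refl) =
  inj₁ (sign≡1⇒∣M (suc (k + k)) (suc k) (cong ℤ.-_ (sign-odd j)) (gauss-odd k pr) , inj₂ h%4≡3)
  where
  h≡3+j*4 : ∀ j → suc (suc (j + j) + suc (j + j)) ≡ 3 + j * 4
  h≡3+j*4 = solve-∀
  h%4≡3 : suc (suc (j + j) + suc (j + j)) % 4 ≡ 3
  h%4≡3 = trans (cong (_% 4) (h≡3+j*4 j)) ([m+kn]%n≡m%n 3 j 4)

M-double : ∀ h → M (h + h) ≡ M h * (2 ^ h + 1)
M-double h = trans (M-+ h h) (factor (M h) (2 ^ h))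
  where
  factor : ∀ m t → m + t * m ≡ m * (t + 1)
  factor = solve-∀

fermat : ∀ h → Prime (suc (2 * h)) → suc (2 * h) ∣ M (h + h)
fermat h pr = subst (suc (2 * h) ∣_) (sym (M-double h)) (divides-either (gauss-2 h pr))
  where
  divides-either : (suc (2 * h) ∣ M h × (h % 4 ≡ 0 ⊎ h % 4 ≡ 3)) ⊎ suc (2 * h) ∣ 2 ^ h + 1 →
                   suc (2 * h) ∣ M h * (2 ^ h + 1)
  divides-either (inj₁ (r∣M , _)) = ∣m⇒∣m*n (2 ^ h + 1) r∣M
  divides-either (inj₂ r∣2^h+1) = ∣n⇒∣m*n (M h) r∣2^h+1

¬∣M∧∣2^+1 : ∀ {r h} → 3 ≤ r → r ∣ M h → r ∣ 2 ^ h + 1 → ⊥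
¬∣M∧∣2^+1 {r} {h} 3≤r r∣M r∣2^h+1 =
  <⇒≱ 3≤r (∣⇒≤ (∣m+n∣m⇒∣n (subst (r ∣_) 2^h+1≡M+2 r∣2^h+1) r∣M))
  where
  2^h+1≡M+2 : 2 ^ h + 1 ≡ M h + 2
  2^h+1≡M+2 = trans (cong (_+ 1) (sym (suc-M h))) (shift (M h))
    where
    shift : ∀ m → suc m + 1 ≡ m + 2
    shift = solve-∀

-- p ∣ M (p - 1) by Fermat, so p ∣ M (gcd m (p - 1)) = M 1.
prime∤M : ∀ {p} m → Prime p → p ≢ 2 → (∀ {s} → Prime s → s ∣ m → s ≡ p) → ¬ p ∣ M m
prime∤M {p} m pp p≢2 only-p p∣Mm with oddPrime⇒≡2h+1 pp p≢2
... | 0 , refl = prime≢1 pp refl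
... | h@(suc _) , refl = from-gcd (gcd m (h + h)) refl (gcd[m,n]∣m m (h + h)) (gcd[m,n]∣n m (h + h))
                                 (∣M-gcd {a = m} {b = h + h} p∣Mm (fermat h pp))
  where
  from-gcd : ∀ g → g ≡ gcd m (h + h) → g ∣ m → g ∣ h + h → p ∣ M g → ⊥
  from-gcd 0 g≡ _ _ _ with gcd[m,n]≡0⇒n≡0 m {h + h} (sym g≡)
  ... | ()
  from-gcd 1 _ _ _ p∣1 = prime≢1 pp (∣1⇒≡1 p∣1)
  from-gcd g@(suc (suc _)) _ g∣m g∣h+h _ with ∃primeFactor {g} (s≤s (s≤s z≤n))
  ... | s , ps , s∣g with only-p ps (∣-trans s∣g g∣m)
  ...   | refl = <⇒≱ (s≤s (≤-reflexive (h+h≡2*h h))) (∣⇒≤ (∣-trans s∣g g∣h+h))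
    where
    h+h≡2*h : ∀ h → h + h ≡ 2 * h
    h+h≡2*h = solve-∀

odd%4 : ∀ h → suc (2 * h) % 4 ≡ 1 ⊎ suc (2 * h) % 4 ≡ 3
odd%4 h with parity h
... | inj₁ (k , refl) = inj₁ (trans (cong (_% 4) (expand k)) ([m+kn]%n≡m%n 1 k 4))
  where
  expand : ∀ k → suc (2 * (k + k)) ≡ 1 + k * 4
  expand = solve-∀
... | inj₂ (k , refl) = inj₂ (trans (cong (_% 4) (expand k)) ([m+kn]%n≡m%n 3 k 4))
  where
  expand : ∀ k → suc (2 * suc (k + k)) ≡ 3 + k * 4
  expand = solve-∀

residue-table : ∀ a b → a < 4 → b ≡ 1 ⊎ b ≡ 3 → (a * b) % 4 ≡ 0 ⊎ (a * b) % 4 ≡ 3 →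
                a ≡ 0 ⊎ (a + b) % 4 ≡ 0
residue-table 0 _ _ _ _ = inj₁ refl
residue-table 1 .1 _ (inj₁ refl) (inj₁ ())
residue-table 1 .1 _ (inj₁ refl) (inj₂ ())
residue-table 1 .3 _ (inj₂ refl) _ = inj₂ refl
residue-table 2 .1 _ (inj₁ refl) (inj₁ ())
residue-table 2 .1 _ (inj₁ refl) (inj₂ ())
residue-table 2 .3 _ (inj₂ refl) (inj₁ ())
residue-table 2 .3 _ (inj₂ refl) (inj₂ ())
residue-table 3 .1 _ (inj₁ refl) _ = inj₂ refl
residue-table 3 .3 _ (inj₂ refl) (inj₁ ())
residue-table 3 .3 _ (inj₂ refl) (inj₂ ())
residue-table (suc (suc (suc (suc _)))) _ (s≤s (s≤s (s≤s (s≤s ())))) _ _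

l*p≡0,3⇒l≡0,-p : ∀ l p → p % 4 ≡ 1 ⊎ p % 4 ≡ 3 → (l * p) % 4 ≡ 0 ⊎ (l * p) % 4 ≡ 3 →
                 l % 4 ≡ 0 ⊎ (l + p) % 4 ≡ 0
l*p≡0,3⇒l≡0,-p l p p%4 lp%4 with residue-table (l % 4) (p % 4) (m%n<n l 4) p%4 (reduce lp%4)
  where
  reduce : (l * p) % 4 ≡ 0 ⊎ (l * p) % 4 ≡ 3 → (l % 4 * (p % 4)) % 4 ≡ 0 ⊎ (l % 4 * (p % 4)) % 4 ≡ 3
  reduce (inj₁ e) = inj₁ (trans (sym (%-distribˡ-* l p 4)) e)
  reduce (inj₂ e) = inj₂ (trans (sym (%-distribˡ-* l p 4)) e)
... | inj₁ l%4≡0 = inj₁ l%4≡0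
... | inj₂ e = inj₂ (trans (%-distribˡ-+ l p 4) e)

-- r = 2h + 1 divides M (gcd p 2h), forcing p ∣ h; then 2 is a square mod r, so r ≡ ±1 (mod 8).
prime∣M⇒≡2lp+1 : ∀ {p r} → Prime p → p ≢ 2 → Prime r → r ∣ M p →
                 ∃[ l ] (r ≡ 2 * l * p + 1 × 0 < l × (l % 4 ≡ 0 ⊎ (l + p) % 4 ≡ 0))
prime∣M⇒≡2lp+1 {p} {r} pp p≢2 pr r∣Mp with oddPrime⇒≡2h+1 pr (∣M⇒≢2 (<⇒≤ (prime≥2 pp)) r∣Mp)
... | h , refl = from-gcd (gcd p (h + h)) (gcd[m,n]∣m p (h + h)) (gcd[m,n]∣n p (h + h))
                          (∣M-gcd {a = p} {b = h + h} r∣Mp (fermat h pr))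
  where
  from-multiple : ∀ l → h ≡ l * p →
                  ∃[ l ] (suc (2 * h) ≡ 2 * l * p + 1 × 0 < l × (l % 4 ≡ 0 ⊎ (l + p) % 4 ≡ 0))
  from-multiple 0 refl = ⊥-elim (prime≢1 pr refl)
  from-multiple l@(suc _) refl = l , regroup l p , s≤s z≤n , l-residue (gauss-2 h pr)
    where
    regroup : ∀ l p → suc (2 * (l * p)) ≡ 2 * l * p + 1
    regroup = solve-∀
    r∣Mh : suc (2 * h) ∣ M h
    r∣Mh = ∣-trans r∣Mp (M-mono-∣ {p} (n∣m*n l))
    3≤r : 3 ≤ suc (2 * h)
    3≤r = s≤s (*-monoʳ-≤ 2 (≤-trans (s≤s z≤n) (≤-trans (prime≥2 pp) (m≤m+n p _))))
    p%4 : p % 4 ≡ 1 ⊎ p % 4 ≡ 3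
    p%4 with oddPrime⇒≡2h+1 pp p≢2
    ... | k , refl = odd%4 k
    l-residue : (suc (2 * h) ∣ M h × (h % 4 ≡ 0 ⊎ h % 4 ≡ 3)) ⊎ suc (2 * h) ∣ 2 ^ h + 1 →
                l % 4 ≡ 0 ⊎ (l + p) % 4 ≡ 0
    l-residue (inj₁ (_ , h%4)) = l*p≡0,3⇒l≡0,-p l p p%4 h%4
    l-residue (inj₂ r∣2^h+1) = ⊥-elim (¬∣M∧∣2^+1 {h = h} 3≤r r∣Mh r∣2^h+1)
  from-gcd : ∀ g → g ∣ p → g ∣ h + h → suc (2 * h) ∣ M g →
             ∃[ l ] (suc (2 * h) ≡ 2 * l * p + 1 × 0 < l × (l % 4 ≡ 0 ⊎ (l + p) % 4 ≡ 0))
  from-gcd g g∣p g∣h+h r∣Mg with prime⇒irreducible pp g∣p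
  ... | inj₁ refl = ⊥-elim (prime≢1 pr (∣1⇒≡1 r∣Mg))
  ... | inj₂ refl with euclidsLemma 2 h pp (subst (p ∣_) (cong (λ z → h + z) (sym (+-identityʳ h))) g∣h+h)
  ...   | inj₁ p∣2 = ⊥-elim (p≢2 (prime∣prime⇒≡ pp prime[2] p∣2))
  ...   | inj₂ (divides l h≡) = from-multiple l h≡

PrimeDivisorsIn : ℕ → ℕ → ℕ → Set
PrimeDivisorsIn m a b = ∀ {r} → Prime r → r ∣ m → r ≡ a ⊎ r ≡ b

primeDivisorsIn-∣ : ∀ {d m a b} → d ∣ m → PrimeDivisorsIn m a b → PrimeDivisorsIn d a b
primeDivisorsIn-∣ d∣m in-ab pr r∣d = in-ab pr (∣-trans r∣d d∣m)

primeDivisorsIn⇒≡^*^ : ∀ {x y} C → 1 ≤ C → PrimeDivisorsIn C x y → ∃[ i ] ∃[ j ] (C ≡ x ^ i * y ^ j)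
primeDivisorsIn⇒≡^*^ {x} {y} = <-rec _ go
  where
  go : ∀ C → (∀ {C′} → C′ < C → 1 ≤ C′ → PrimeDivisorsIn C′ x y → ∃[ i ] ∃[ j ] (C′ ≡ x ^ i * y ^ j)) →
       1 ≤ C → PrimeDivisorsIn C x y → ∃[ i ] ∃[ j ] (C ≡ x ^ i * y ^ j)
  go 1 _ _ _ = 0 , 0 , refl
  go C@(suc (suc _)) rec _ in-xy with ∃primeFactor {C} (s≤s (s≤s z≤n))
  ... | r , pr , divides c@(suc _) C≡c*r
        with rec {c} (subst (c <_) (sym C≡c*r) (m<m*n c r (prime≥2 pr))) (s≤s z≤n)
                 (primeDivisorsIn-∣ (divides r (trans C≡c*r (*-comm c r))) in-xy)
  ...   | i , j , c≡ with in-xy pr (divides c C≡c*r)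
  ...     | inj₁ refl = suc i , j , trans C≡c*r (trans (cong (_* x) c≡) (regroup (x ^ i) (y ^ j) x))
    where
    regroup : ∀ u v x → u * v * x ≡ x * u * v
    regroup = solve-∀
  ...     | inj₂ refl = i , suc j , trans C≡c*r (trans (cong (_* y) c≡) (regroup (x ^ i) (y ^ j) y))
    where
    regroup : ∀ u v y → u * v * y ≡ u * (y * v)
    regroup = solve-∀

exponent>0 : ∀ {C x y} s t → C ≡ x ^ s * y ^ t → x ∣ C → Prime x → Prime y → x ≢ y → 0 < s
exponent>0 (suc _) _ _ _ _ _ _ = s≤s z≤n
exponent>0 {x = x} {y} zero t C≡ x∣C px py x≢y =
  ⊥-elim (x≢y (prime∣prime⇒≡ px py (prime∣^⇒prime∣ t px (subst (x ∣_) (trans C≡ (*-identityˡ (y ^ t))) x∣C))))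

^-distrib-* : ∀ a b e → (a * b) ^ e ≡ a ^ e * b ^ e
^-distrib-* a b zero = refl
^-distrib-* a b (suc e) = trans (cong (a * b *_) (^-distrib-* a b e)) (regroup a b (a ^ e) (b ^ e))
  where
  regroup : ∀ a b u v → a * b * (u * v) ≡ a * u * (b * v)
  regroup = solve-∀

2∤odd : ∀ t → ¬ 2 ∣ suc (2 * t)
2∤odd t 2∣ with trans (sym (n∣m⇒m%n≡0 _ 2 2∣)) (trans (cong (_% 2) (expand t)) ([m+kn]%n≡m%n 1 t 2))
  where
  expand : ∀ t → suc (2 * t) ≡ 1 + t * 2
  expand = solve-∀
... | ()

odd∣2^⇒≡1 : ∀ t p → suc (2 * t) ∣ 2 ^ p → t ≡ 0
odd∣2^⇒≡1 zero _ _ = refl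
odd∣2^⇒≡1 (suc t) p odd∣2^p with ∃primeFactor {suc (2 * suc t)} (s≤s (s≤s z≤n))
... | s , ps , s∣odd with prime∣prime⇒≡ ps prime[2] (prime∣^⇒prime∣ p ps (∣-trans s∣odd odd∣2^p))
...   | refl = ⊥-elim (2∤odd (suc t) s∣odd)

square%4 : ∀ Y → (Y * Y) % 4 ≡ 0 ⊎ (Y * Y) % 4 ≡ 1
square%4 Y with parity Y
... | inj₁ (k , refl) = inj₁ (trans (cong (_% 4) (expand k)) (m*n%n≡0 (k * k) 4))
  where
  expand : ∀ k → (k + k) * (k + k) ≡ k * k * 4
  expand = solve-∀
... | inj₂ (k , refl) = inj₂ (trans (cong (_% 4) (expand k)) ([m+kn]%n≡m%n 1 (k * k + k) 4))
  where
  expand : ∀ k → suc (k + k) * suc (k + k) ≡ 1 + (k * k + k) * 4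
  expand = solve-∀

-- For odd Y and odd e, Y + 1 divides Y^e + 1 with an odd cofactor Y^(e-1) - Y^(e-2) + ⋯ + 1.
odd^odd+1 : ∀ y k → ∃[ t ] (suc (suc (2 * y)) * suc (2 * t) ≡ suc (2 * y) ^ suc (2 * k) + 1)
odd^odd+1 y zero = 0 , base y
  where
  base : ∀ y → suc (suc (2 * y)) * 1 ≡ suc (2 * y) * 1 + 1
  base = solve-∀
odd^odd+1 y (suc k) with odd^odd+1 y k
... | t , eq = Y * u , +-cancelʳ-≡ (Y * Y) _ _ (begin
    suc Y * suc (2 * (Y * u)) + Y * Y  ≡⟨ step y t ⟩
    Y * Y * (suc Y * suc (2 * t)) + 1  ≡⟨ cong (λ z → Y * Y * z + 1) eq ⟩
    Y * Y * (Z + 1) + 1                ≡⟨ shift Y Z ⟩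
    Y * (Y * Z) + 1 + Y * Y            ≡⟨ cong (λ z → Y ^ z + 1 + Y * Y) (cong suc (*-suc 2 k)) ⟨
    Y ^ suc (2 * suc k) + 1 + Y * Y    ∎)
  where
  open ≡-Reasoning
  Y u Z : ℕ
  Y = suc (2 * y)
  u = 2 * y * t + y + t
  Z = Y ^ suc (2 * k)
  step : ∀ y t → suc (suc (2 * y)) * suc (2 * (suc (2 * y) * (2 * y * t + y + t))) + suc (2 * y) * suc (2 * y)
               ≡ suc (2 * y) * suc (2 * y) * (suc (suc (2 * y)) * suc (2 * t)) + 1
  step = solve-∀
  shift : ∀ Y Z → Y * Y * (Z + 1) + 1 ≡ Y * (Y * Z) + 1 + Y * Y
  shift = solve-∀

M≢1 : ∀ {p} → 2 ≤ p → M p ≢ 1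
M≢1 2≤p Mp≡1 with subst (3 ≤_) Mp≡1 (M≥3 2≤p)
... | s≤s ()

M%4≡3 : ∀ {p} → 2 ≤ p → M p % 4 ≡ 3
M%4≡3 {1} (s≤s ())
M%4≡3 {suc (suc q)} _ = trans (cong (_% 4) (M[2+n]≡3+M[n]*4 q)) ([m+kn]%n≡m%n 3 (M q) 4)

M≢square : ∀ {p} Y → 2 ≤ p → M p ≢ Y * Y
M≢square {p} Y 2≤p Mp≡Y² = not-square (square%4 Y)
  where
  Y²%4≡3 : (Y * Y) % 4 ≡ 3
  Y²%4≡3 = trans (cong (_% 4) (sym Mp≡Y²)) (M%4≡3 2≤p)
  not-square : (Y * Y) % 4 ≡ 0 ⊎ (Y * Y) % 4 ≡ 1 → ⊥
  not-square (inj₁ Y²%4≡0) with trans (sym Y²%4≡3) Y²%4≡0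
  ... | ()
  not-square (inj₂ Y²%4≡1) with trans (sym Y²%4≡3) Y²%4≡1
  ... | ()

-- Y^e = 2^p - 1 with e odd would make the odd cofactor of Y + 1 in Y^e + 1 = 2^p equal to 1,
-- forcing Y^e = Y, so Y = 1.
M≢odd^ : ∀ {p} Y h → 2 ≤ p → M p ≢ Y ^ suc (2 * suc h)
M≢odd^ {p} Y h 2≤p Mp≡Y^e with parity Y
... | inj₁ (j , refl) = M-odd (<⇒≤ 2≤p) (subst (2 ∣_) (sym Mp≡Y^e) (∣m⇒∣m*n _ (divides j (j+j≡j*2 j))))
  where
  j+j≡j*2 : ∀ j → j + j ≡ j * 2
  j+j≡j*2 = solve-∀
... | inj₂ (j , refl) = cofactor-odd (odd^odd+1 j (suc h))
  where
  Y′ e : ℕ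
  Y′ = suc (2 * j)
  e = suc (2 * suc h)
  Mp≡Y′^e : M p ≡ Y′ ^ e
  Mp≡Y′^e = trans Mp≡Y^e (cong (λ z → suc z ^ e) (j+j≡2*j j))
    where
    j+j≡2*j : ∀ j → j + j ≡ 2 * j
    j+j≡2*j = solve-∀
  cofactor-odd : ∃[ t ] (suc Y′ * suc (2 * t) ≡ Y′ ^ e + 1) → ⊥
  cofactor-odd (t , eq) with odd∣2^⇒≡1 t p (divides (suc Y′) 2^p≡)
    where
    2^p≡ : 2 ^ p ≡ suc Y′ * suc (2 * t)
    2^p≡ = trans (sym (suc-M p)) (trans (+-comm 1 (M p)) (trans (cong (_+ 1) Mp≡Y′^e) (sym eq)))
  ... | refl with m^n≡1⇒n≡0∨m≡1 Y′ (2 * suc h) (*-cancelˡ-≡ _ _ Y′ (trans Y′^e≡Y′ (sym (*-identityʳ Y′))))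
    where
    Y′^e≡Y′ : Y′ * Y′ ^ (2 * suc h) ≡ Y′
    Y′^e≡Y′ = +-cancelʳ-≡ 1 _ _ (trans (sym eq) (trans (*-identityʳ (suc Y′)) (+-comm 1 Y′)))
  ...   | inj₂ Y′≡1 = M≢1 2≤p (trans Mp≡Y′^e (trans (cong (_^ e) Y′≡1) (^-zeroˡ e)))

M≢^prime : ∀ {p e} Y → 2 ≤ p → Prime e → M p ≢ Y ^ e
M≢^prime {e = e} Y 2≤p pe Mp≡Y^e with e ≟ 2
... | yes refl = M≢square Y 2≤p (trans Mp≡Y^e (cong (Y *_) (*-identityʳ Y)))
... | no e≢2 with oddPrime⇒≡2h+1 pe e≢2
...   | 0 , refl = prime≢1 pe refl
...   | suc h , refl = M≢odd^ Y h 2≤p Mp≡Y^e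

gcd-exponents≡1 : ∀ {p x y s t} → 2 ≤ p → M p ≡ x ^ s * y ^ t → 0 < s → gcd s t ≡ 1
gcd-exponents≡1 {p} {x} {y} {s} {t} 2≤p Mp≡ 0<s = from-gcd (gcd s t) refl (gcd[m,n]∣m s t) (gcd[m,n]∣n s t)
  where
  from-gcd : ∀ g → g ≡ gcd s t → g ∣ s → g ∣ t → g ≡ 1
  from-gcd 0 g≡ _ _ = ⊥-elim (<⇒≢ 0<s (sym (gcd[m,n]≡0⇒m≡0 {s} {t} (sym g≡))))
  from-gcd 1 _ _ _ = refl
  from-gcd g@(suc (suc _)) _ g∣s g∣t with ∃primeFactor {g} (s≤s (s≤s z≤n))
  ... | e , pe , e∣g with ∣-trans e∣g g∣s | ∣-trans e∣g g∣t
  ...   | divides s′ refl | divides t′ refl = ⊥-elim (M≢^prime (x ^ s′ * y ^ t′) 2≤p pe (begin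
      M p                                ≡⟨ Mp≡ ⟩
      x ^ (s′ * e) * y ^ (t′ * e)        ≡⟨ cong₂ _*_ (^-*-assoc x s′ e) (^-*-assoc y t′ e) ⟨
      (x ^ s′) ^ e * (y ^ t′) ^ e        ≡⟨ ^-distrib-* (x ^ s′) (y ^ t′) e ⟨
      (x ^ s′ * y ^ t′) ^ e              ∎))
    where open ≡-Reasoning

record TwoPrimeDivisors (m : ℕ) : Set where
  field
    a b : ℕ
    a≢b : a ≢ b
    prime-a : Prime a
    a∣m : a ∣ m
    prime-b : Prime b
    b∣m : b ∣ m
    in-ab : PrimeDivisorsIn m a b

∈primeDivisors : ∀ {m r} → 1 ≤ m → Prime r → r ∣ m → r ∈ primeDivisors m
∈primeDivisors {suc m} {suc r} _ pr r∣m =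
  ∈-filter⁺ prime? (∈-filter⁺ (_∣? suc m) (∈-map⁺ suc (∈-upTo⁺ (∣⇒≤ r∣m))) r∣m) pr

∈primeDivisors⇒ : ∀ {m r} → r ∈ primeDivisors m → Prime r × r ∣ m
∈primeDivisors⇒ {m} r∈ with ∈-filter⁻ prime? r∈
... | r∈′ , pr = pr , proj₂ (∈-filter⁻ (_∣? m) {xs = map suc (upTo m)} r∈′)

primeDivisors-unique : ∀ m → Unique (primeDivisors m)
primeDivisors-unique m = filter⁺ prime? (filter⁺ (_∣? m) (map⁺ suc-injective (upTo⁺ m)))

ω≡2⇒twoPrimeDivisors : ∀ {m} → 1 ≤ m → ω m ≡ 2 → TwoPrimeDivisors m
ω≡2⇒twoPrimeDivisors {m} 1≤m ω≡2 =
  from-list (primeDivisors m) ω≡2 (primeDivisors-unique m) ∈primeDivisors⇒ (∈primeDivisors 1≤m)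
  where
  from-list : (xs : List ℕ) → length xs ≡ 2 → Unique xs → (∀ {r} → r ∈ xs → Prime r × r ∣ m) →
              (∀ {r} → Prime r → r ∣ m → r ∈ xs) → TwoPrimeDivisors m
  from-list (a ∷ b ∷ []) refl ((a≢b ∷ []) ∷ _) sound complete = record
    { a = a ; b = b ; a≢b = a≢b
    ; prime-a = proj₁ (sound (here refl)) ; a∣m = proj₂ (sound (here refl))
    ; prime-b = proj₁ (sound (there (here refl))) ; b∣m = proj₂ (sound (there (here refl)))
    ; in-ab = λ pr r∣m → in-pair (complete pr r∣m) }
    where
    in-pair : ∀ {r} → r ∈ a ∷ b ∷ [] → r ≡ a ⊎ r ≡ b
    in-pair (here r≡a) = inj₁ r≡a
    in-pair (there (here r≡b)) = inj₂ r≡b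

primeDivisorsIn-renew : ∀ {m a b u v} → PrimeDivisorsIn m a b → Prime u → u ∣ m → Prime v → v ∣ m → u ≢ v →
                        PrimeDivisorsIn m u v
primeDivisorsIn-renew {m} {a} {b} {u} {v} in-ab pu u∣m pv v∣m u≢v pr r∣m =
  pick (in-ab pr r∣m) (in-ab pu u∣m) (in-ab pv v∣m)
  where
  pick : ∀ {r} → r ≡ a ⊎ r ≡ b → u ≡ a ⊎ u ≡ b → v ≡ a ⊎ v ≡ b → r ≡ u ⊎ r ≡ v
  pick (inj₁ refl) (inj₁ refl) _ = inj₁ refl
  pick (inj₂ refl) (inj₂ refl) _ = inj₁ refl
  pick (inj₁ refl) (inj₂ refl) (inj₁ refl) = inj₂ refl
  pick (inj₂ refl) (inj₁ refl) (inj₂ refl) = inj₂ refl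
  pick (inj₁ refl) (inj₂ refl) (inj₂ refl) = ⊥-elim (u≢v refl)
  pick (inj₂ refl) (inj₁ refl) (inj₁ refl) = ⊥-elim (u≢v refl)

three-primes⇒¬primeDivisorsIn : ∀ {m a b r₁ r₂ r₃} → Prime r₁ → r₁ ∣ m → Prime r₂ → r₂ ∣ m → Prime r₃ → r₃ ∣ m →
                                r₁ ≢ r₂ → r₁ ≢ r₃ → r₂ ≢ r₃ → ¬ PrimeDivisorsIn m a b
three-primes⇒¬primeDivisorsIn p₁ r₁∣m p₂ r₂∣m p₃ r₃∣m r₁≢r₂ r₁≢r₃ r₂≢r₃ in-ab
  with primeDivisorsIn-renew in-ab p₁ r₁∣m p₂ r₂∣m r₁≢r₂ p₃ r₃∣m
... | inj₁ refl = r₁≢r₃ refl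
... | inj₂ refl = r₂≢r₃ refl

k≤geom : ∀ z .{{_ : NonZero z}} k → k ≤ geom z k
k≤geom z zero = z≤n
k≤geom z (suc k) = subst (_≤ geom z k + z ^ k) (+-comm k 1) (+-mono-≤ (k≤geom z k) (m^n>0 z k))

¬prime∣M∧geom : ∀ {p a r} → Prime p → p ≢ 2 → (∀ {s} → Prime s → s ∣ a → s ≡ p) →
                Prime r → r ∣ M a → ¬ r ∣ geom (2 ^ a) p
¬prime∣M∧geom {p} {a} pp p≢2 only-p pr r∣Ma r∣geom
  with prime∣prime⇒≡ pr pp (∣M∧∣geom⇒∣ {a = a} p r∣Ma r∣geom)
... | refl = prime∤M a pp p≢2 only-p r∣Ma

only-prime∣p*p : ∀ {p s} → Prime p → Prime s → s ∣ p * p → s ≡ p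
only-prime∣p*p {p} pp ps s∣p*p with euclidsLemma p p ps s∣p*p
... | inj₁ s∣p = prime∣prime⇒≡ ps pp s∣p
... | inj₂ s∣p = prime∣prime⇒≡ ps pp s∣p

-- M (p²) = M p · geom (2^p) p with coprime factors; the second factor must take the remaining prime.
M[p*p]≡M[p]*q^t : ∀ {n p a b} → Prime p → p ≢ 2 → n ≡ p * p → PrimeDivisorsIn (M n) a b →
                  ∃[ q ] ∃[ t ] (Prime q × 0 < t × M n ≡ M p * q ^ t)
M[p*p]≡M[p]*q^t {p = p} pp p≢2 refl in-ab =
  from-primes (∃prime∣M (prime≥2 pp)) (∃primeFactor 2≤S)
  where
  S : ℕ
  S = geom (2 ^ p) p
  2≤S : 2 ≤ S
  2≤S = ≤-trans (prime≥2 pp) (k≤geom (2 ^ p) {{m^n≢0 2 p}} p)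
  S∣ : S ∣ M (p * p)
  S∣ = divides (M p) (M-* p p)
  ¬common : ∀ {r} → Prime r → r ∣ M p → ¬ r ∣ S
  ¬common = ¬prime∣M∧geom pp p≢2 (λ ps → prime∣prime⇒≡ ps pp)
  from-primes : ∃[ u ] (Prime u × u ∣ M p) → ∃[ w ] (Prime w × w ∣ S) →
                ∃[ q ] ∃[ t ] (Prime q × 0 < t × M (p * p) ≡ M p * q ^ t)
  from-primes (u , pu , u∣Mp) (w , pw , w∣S) = from-exponents (primeDivisorsIn⇒≡^*^ S (<⇒≤ 2≤S) in-w)
    where
    in-uw : PrimeDivisorsIn (M (p * p)) u w
    in-uw = primeDivisorsIn-renew in-ab pu (∣-trans u∣Mp (M-mono-∣ {p} (m∣m*n p))) pw (∣-trans w∣S S∣)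
                                  (λ { refl → ¬common pu u∣Mp w∣S })
    in-w : PrimeDivisorsIn S w w
    in-w pr r∣S with in-uw pr (∣-trans r∣S S∣)
    ... | inj₁ refl = ⊥-elim (¬common pr u∣Mp r∣S)
    ... | inj₂ r≡w = inj₁ r≡w
    from-exponents : ∃[ i ] ∃[ j ] (S ≡ w ^ i * w ^ j) →
                     ∃[ q ] ∃[ t ] (Prime q × 0 < t × M (p * p) ≡ M p * q ^ t)
    from-exponents (i , j , S≡) =
      w , i + j , pw , 0<i+j i j S≡ , trans (M-* p p) (cong (M p *_) (trans S≡ (sym (^-distribˡ-+-* w i j))))
      where
      0<i+j : ∀ i j → S ≡ w ^ i * w ^ j → 0 < i + j
      0<i+j (suc _) _ _ = s≤s z≤n
      0<i+j zero (suc _) _ = s≤s z≤n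
      0<i+j zero zero S≡1 = ⊥-elim (<⇒≱ 2≤S (≤-reflexive S≡1))

M[p]≡p^s*q^t : ∀ {n p₁} → Prime p₁ → p₁ ≢ 2 → n ≡ p₁ → TwoPrimeDivisors (M n) →
  ∃[ p ] ∃[ q ] ∃[ s ] ∃[ t ] ∃[ l₁ ] ∃[ l₂ ]
    (Prime p × Prime q × p ≢ q × p % 2 ≡ 1 × q % 2 ≡ 1
    × 0 < s × 0 < t × gcd s t ≡ 1
    × M n ≡ p ^ s * q ^ t
    × p ≡ 2 * l₁ * p₁ + 1 × q ≡ 2 * l₂ * p₁ + 1
    × 0 < l₁ × 0 < l₂ × l₁ ≢ l₂
    × ((l₁ % 4 ≡ 0) ⊎ ((l₁ + p₁) % 4 ≡ 0))
    × ((l₂ % 4 ≡ 0) ⊎ ((l₂ + p₁) % 4 ≡ 0)))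
M[p]≡p^s*q^t {p₁ = p₁} pp₁ p₁≢2 refl two with primeDivisorsIn⇒≡^*^ (M p₁) (M≥1 (<⇒≤ (prime≥2 pp₁))) in-ab
                                  | prime∣M⇒≡2lp+1 pp₁ p₁≢2 prime-a a∣m
                                  | prime∣M⇒≡2lp+1 pp₁ p₁≢2 prime-b b∣m
  where open TwoPrimeDivisors two
... | s , t , Mp₁≡ | l₁ , a≡ , 0<l₁ , l₁%4 | l₂ , b≡ , 0<l₂ , l₂%4 =
  a , b , s , t , l₁ , l₂ , prime-a , prime-b , a≢b , odd%2 prime-a a∣m , odd%2 prime-b b∣m ,
  0<s , 0<t , gcd-exponents≡1 (prime≥2 pp₁) Mp₁≡ 0<s , Mp₁≡ , a≡ , b≡ , 0<l₁ , 0<l₂ , l₁≢l₂ , l₁%4 , l₂%4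
  where
  open TwoPrimeDivisors two
  1≤p₁ : 1 ≤ p₁
  1≤p₁ = <⇒≤ (prime≥2 pp₁)
  odd%2 : ∀ {r} → Prime r → r ∣ M p₁ → r % 2 ≡ 1
  odd%2 {r} pr r∣M with oddPrime⇒≡2h+1 pr (∣M⇒≢2 1≤p₁ r∣M)
  ... | h , refl = trans (cong (_% 2) (expand h)) ([m+kn]%n≡m%n 1 h 2)
    where
    expand : ∀ h → suc (2 * h) ≡ 1 + h * 2
    expand = solve-∀
  0<s : 0 < s
  0<s = exponent>0 s t Mp₁≡ a∣m prime-a prime-b a≢b
  0<t : 0 < t
  0<t = exponent>0 t s (trans Mp₁≡ (*-comm (a ^ s) (b ^ t))) b∣m prime-b prime-a (≢-sym a≢b)
  l₁≢l₂ : l₁ ≢ l₂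
  l₁≢l₂ l₁≡l₂ = a≢b (trans a≡ (trans (cong (λ l → 2 * l * p₁ + 1) l₁≡l₂) (sym b≡)))

≤-from-+ : ∀ {a b} d → a + d ≡ b → a ≤ b
≤-from-+ {a} d refl = m≤m+n a d

z^k*[1+z]≤geom : ∀ z k → z ^ k * (1 + z) ≤ geom z (2 + k)
z^k*[1+z]≤geom z k = ≤-from-+ (geom z k) (regroup (z ^ k) (geom z k) z)
  where
  regroup : ∀ w g z → w * (1 + z) + g ≡ g + w + z * w
  regroup = solve-∀

-- Equality holds at p = 2, q = 5.
2^5*5p≤z³[1+z] : ∀ p′ → 2 ^ 5 * (5 * (2 + p′)) ≤ (2 ^ (2 + p′)) ^ 3 * (1 + 2 ^ (2 + p′))
2^5*5p≤z³[1+z] zero = ≤-refl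
2^5*5p≤z³[1+z] (suc p′) = begin
    2 ^ 5 * (5 * (3 + p′))                     ≡⟨ split p′ ⟩
    160 + L                                    ≤⟨ +-monoˡ-≤ L (≤-from-+ {160} {L} (160 + 160 * p′) (160≤L p′)) ⟩
    L + L                                      ≤⟨ +-mono-≤ (2^5*5p≤z³[1+z] p′) (2^5*5p≤z³[1+z] p′) ⟩
    z ^ 3 * (1 + z) + z ^ 3 * (1 + z)          ≤⟨ ≤-from-+ (6 * (z * z * z) + 14 * (z * z * z * z)) (double z) ⟩
    (2 * z) ^ 3 * (1 + 2 * z)                  ∎
  where
  open ≤-Reasoning
  z L : ℕ
  z = 2 ^ (2 + p′)
  L = 2 ^ 5 * (5 * (2 + p′))
  split : ∀ p′ → 2 ^ 5 * (5 * (3 + p′)) ≡ 160 + 2 ^ 5 * (5 * (2 + p′))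
  split = solve-∀
  160≤L : ∀ p′ → 160 + (160 + 160 * p′) ≡ 2 ^ 5 * (5 * (2 + p′))
  160≤L = solve-∀
  double : ∀ z → z * (z * (z * 1)) * (1 + z) + z * (z * (z * 1)) * (1 + z)
                   + (6 * (z * z * z) + 14 * (z * z * z * z))
               ≡ (2 * z) * ((2 * z) * ((2 * z) * 1)) * (1 + 2 * z)
  double = solve-∀

2^q*qp≤z^[q-2]*[1+z] : ∀ p′ k′ →
  2 ^ (5 + k′) * ((5 + k′) * (2 + p′)) ≤ (2 ^ (2 + p′)) ^ (3 + k′) * (1 + 2 ^ (2 + p′))
2^q*qp≤z^[q-2]*[1+z] p′ zero = 2^5*5p≤z³[1+z] p′
2^q*qp≤z^[q-2]*[1+z] p′ (suc k′) = begin
    2 * t * ((6 + k′) * p)          ≤⟨ ≤-from-+ (2 * t * ((4 + k′) * p)) (regroup t k′ p) ⟩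
    4 * (t * ((5 + k′) * p))        ≤⟨ *-monoʳ-≤ 4 (2^q*qp≤z^[q-2]*[1+z] p′ k′) ⟩
    4 * (z ^ (3 + k′) * (1 + z))    ≤⟨ *-monoˡ-≤ (z ^ (3 + k′) * (1 + z)) 4≤z ⟩
    z * (z ^ (3 + k′) * (1 + z))    ≡⟨ *-assoc z (z ^ (3 + k′)) (1 + z) ⟨
    z ^ (4 + k′) * (1 + z)          ∎
  where
  open ≤-Reasoning
  p t z : ℕ
  p = 2 + p′
  t = 2 ^ (5 + k′)
  z = 2 ^ p
  4≤z : 4 ≤ z
  4≤z = ^-monoʳ-≤ 2 (m≤m+n 2 p′)
  regroup : ∀ t k′ p → 2 * t * ((6 + k′) * p) + 2 * t * ((4 + k′) * p) ≡ 4 * (t * ((5 + k′) * p))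
  regroup = solve-∀

M[p]*M[q]*qp<M[pq] : ∀ {p q} → 2 ≤ p → 5 ≤ q → M p * M q * (q * p) < M (p * q)
M[p]*M[q]*qp<M[pq] {suc (suc p′)} {suc (suc (suc (suc (suc k′))))} (s≤s (s≤s _)) (s≤s (s≤s (s≤s (s≤s (s≤s _))))) =
  begin-strict
    M p * M q * (q * p)      ≡⟨ *-assoc (M p) (M q) (q * p) ⟩
    M p * (M q * (q * p))    <⟨ *-monoʳ-< (M p) {{>-nonZero (M≥1 {p} (s≤s z≤n))}} Mq*qp<geom ⟩
    M p * geom (2 ^ p) q     ≡⟨ M-* p q ⟨
    M (p * q)                ∎
  where
  open ≤-Reasoning
  p q : ℕ
  p = 2 + p′
  q = 5 + k′
  Mq*qp<geom : M q * (q * p) < geom (2 ^ p) q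
  Mq*qp<geom = begin-strict
      M q * (q * p)                    <⟨ *-monoˡ-< (q * p) (subst (M q <_) (suc-M q) ≤-refl) ⟩
      2 ^ q * (q * p)                  ≤⟨ 2^q*qp≤z^[q-2]*[1+z] p′ k′ ⟩
      (2 ^ p) ^ (3 + k′) * (1 + 2 ^ p) ≤⟨ z^k*[1+z]≤geom (2 ^ p) (3 + k′) ⟩
      geom (2 ^ p) q                   ∎

gcd-distinct-primes≡1 : ∀ {p q} → Prime p → Prime q → p ≢ q → gcd p q ≡ 1
gcd-distinct-primes≡1 {p} {q} pp pq p≢q with prime⇒irreducible pp (gcd[m,n]∣m p q)
... | inj₁ gcd≡1 = gcd≡1
... | inj₂ gcd≡p = ⊥-elim (p≢q (prime∣prime⇒≡ pp pq (subst (_∣ q) gcd≡p (gcd[m,n]∣n p q))))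

-- Only u = q can divide geom (2^a) q, and only to the first power.
prime^∣geom⇒≤ : ∀ {u q a} i → Prime u → Prime q → u ≢ 2 → u ∣ M a → u ^ i ∣ geom (2 ^ a) q → u ^ i ≤ q
prime^∣geom⇒≤ zero _ pq _ _ _ = <⇒≤ (prime≥2 pq)
prime^∣geom⇒≤ {u} {q} {a} (suc i) pu pq u≢2 u∣Ma u^i∣geom
  with prime∣prime⇒≡ pu pq (∣M∧∣geom⇒∣ {a = a} q u∣Ma (∣-trans (m∣m*n (u ^ i)) u^i∣geom))
... | refl with i
...   | zero = ≤-reflexive (*-identityʳ u)
...   | suc i′ = ⊥-elim (sq∤geom {a = a} pq u≢2 u∣Ma
                   (∣-trans (m∣m*n (u ^ i′)) (subst (_∣ geom (2 ^ a) q) (sym (*-assoc u u (u ^ i′))) u^i∣geom)))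

M[pq]≡M[p]*C*M[q] : ∀ {p q} → Prime p → Prime q → p ≢ q →
                    ∃[ C ] (M (p * q) ≡ M p * (C * M q) × (C ∣ geom (2 ^ p) q) × (C ∣ geom (2 ^ q) p))
M[pq]≡M[p]*C*M[q] {p} {q} pp pq p≢q = C , Mpq≡ , divides (M q) (trans A≡C*Mq (*-comm C (M q))) ,
                                      divides (M p) (trans B≡C*Mp (*-comm C (M p)))
  where
  A B : ℕ
  A = geom (2 ^ p) q
  B = geom (2 ^ q) p
  Mq∣A : M q ∣ A
  Mq∣A = coprime-divisor (M-coprime {q} {p} (gcd-distinct-primes≡1 pq pp (≢-sym p≢q)))
                         (subst (M q ∣_) (trans (cong M (*-comm q p)) (M-* p q))
                                (divides B (trans (M-* q p) (*-comm (M q) B))))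
  C : ℕ
  C = quotient Mq∣A
  A≡C*Mq : A ≡ C * M q
  A≡C*Mq = m∣n⇒n≡quotient*m Mq∣A
  Mpq≡ : M (p * q) ≡ M p * (C * M q)
  Mpq≡ = trans (M-* p q) (cong (M p *_) A≡C*Mq)
  B≡C*Mp : B ≡ C * M p
  B≡C*Mp = *-cancelˡ-≡ B (C * M p) (M q) {{>-nonZero (M≥1 (<⇒≤ (prime≥2 pq)))}} (begin
      M q * B            ≡⟨ M-* q p ⟨
      M (q * p)          ≡⟨ cong M (*-comm q p) ⟩
      M (p * q)          ≡⟨ Mpq≡ ⟩
      M p * (C * M q)    ≡⟨ swap (M p) C (M q) ⟩
      M q * (C * M p)    ∎)
    where
    open ≡-Reasoning
    swap : ∀ x c y → x * (c * y) ≡ y * (c * x)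
    swap = solve-∀

-- With only two prime factors, these are some u ∣ M p and v ∣ M q, so C = u^i v^j; lifting the
-- exponent gives u^i ≤ q and v^j ≤ p, and C ≤ pq is too small.
¬primeDivisorsIn-M[p*q] : ∀ {p q a b} → Prime p → Prime q → p ≢ q → 5 ≤ q → ¬ PrimeDivisorsIn (M (p * q)) a b
¬primeDivisorsIn-M[p*q] {p} {q} pp pq p≢q 5≤q in-ab =
  from-factorisation (M[pq]≡M[p]*C*M[q] pp pq p≢q) (∃prime∣M 2≤p) (∃prime∣M 2≤q)
  where
  2≤p : 2 ≤ p
  2≤p = prime≥2 pp
  2≤q : 2 ≤ q
  2≤q = prime≥2 pq
  from-factorisation : ∃[ C ] (M (p * q) ≡ M p * (C * M q) × (C ∣ geom (2 ^ p) q) × (C ∣ geom (2 ^ q) p)) →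
                       ∃[ u ] (Prime u × u ∣ M p) → ∃[ v ] (Prime v × v ∣ M q) → ⊥
  from-factorisation (C , Mpq≡ , C∣A , C∣B) (u , pu , u∣Mp) (v , pv , v∣Mq) =
    from-exponents (primeDivisorsIn⇒≡^*^ C 1≤C (primeDivisorsIn-∣ C∣Mpq in-uv))
    where
    C∣Mpq : C ∣ M (p * q)
    C∣Mpq = divides (M p * M q) (trans Mpq≡ (swap (M p) C (M q)))
      where
      swap : ∀ x c y → x * (c * y) ≡ x * y * c
      swap = solve-∀
    1≤C : 1 ≤ C
    1≤C = n≢0⇒n>0 λ { refl → <⇒≱ (M≥1 (≤-trans (s≤s z≤n) (*-mono-≤ 2≤p 2≤q)))
                                    (≤-reflexive (trans Mpq≡ (*-zeroʳ (M p)))) }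
    u≢v : u ≢ v
    u≢v refl = prime≢1 pu (M-coprime {p} {q} (gcd-distinct-primes≡1 pp pq p≢q) (u∣Mp , v∣Mq))
    in-uv : PrimeDivisorsIn (M (p * q)) u v
    in-uv = primeDivisorsIn-renew in-ab pu (∣-trans u∣Mp (M-mono-∣ {p} (m∣m*n q)))
                                        pv (∣-trans v∣Mq (M-mono-∣ {q} (n∣m*n p))) u≢v
    from-exponents : ∃[ i ] ∃[ j ] (C ≡ u ^ i * v ^ j) → ⊥
    from-exponents (i , j , C≡) = <⇒≱ (M[p]*M[q]*qp<M[pq] 2≤p 5≤q) (begin
        M (p * q)               ≡⟨ Mpq≡ ⟩
        M p * (C * M q)         ≤⟨ *-monoʳ-≤ (M p) (*-monoˡ-≤ (M q) C≤qp) ⟩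
        M p * (q * p * M q)     ≡⟨ swap (M p) (q * p) (M q) ⟩
        M p * M q * (q * p)     ∎)
      where
      open ≤-Reasoning
      swap : ∀ x c y → x * (c * y) ≡ x * y * c
      swap = solve-∀
      u^i≤q : u ^ i ≤ q
      u^i≤q = prime^∣geom⇒≤ {a = p} i pu pq (∣M⇒≢2 (<⇒≤ 2≤p) u∣Mp) u∣Mp
                (∣-trans (divides (v ^ j) (trans C≡ (*-comm (u ^ i) (v ^ j)))) C∣A)
      v^j≤p : v ^ j ≤ p
      v^j≤p = prime^∣geom⇒≤ {a = q} j pv pp (∣M⇒≢2 (<⇒≤ 2≤q) v∣Mq) v∣Mq (∣-trans (divides (u ^ i) C≡) C∣B)
      C≤qp : C ≤ q * p
      C≤qp = subst (_≤ q * p) (sym C≡) (*-mono-≤ u^i≤q v^j≤p)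

-- M p, geom (2^p) p and geom (2^(p²)) p are pairwise coprime factors of M (p³).
¬primeDivisorsIn-M[p*p*p] : ∀ {p a b} → Prime p → p ≢ 2 → ¬ PrimeDivisorsIn (M (p * p * p)) a b
¬primeDivisorsIn-M[p*p*p] {p} pp p≢2 in-ab with ∃prime∣M (prime≥2 pp)
                                             | ∃primeFactor (2≤geom p) | ∃primeFactor (2≤geom (p * p))
  where
  2≤geom : ∀ a → 2 ≤ geom (2 ^ a) p
  2≤geom a = ≤-trans (prime≥2 pp) (k≤geom (2 ^ a) {{m^n≢0 2 a}} p)
... | r₁ , p₁ , r₁∣Mp | r₂ , p₂ , r₂∣S₁ | r₃ , p₃ , r₃∣S₂ =
  three-primes⇒¬primeDivisorsIn p₁ (∣-trans r₁∣Mp (M-mono-∣ {p} (n∣m*n (p * p))))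
                                p₂ (∣-trans r₂∣Mpp (M-mono-∣ {p * p} (m∣m*n p)))
                                p₃ (∣-trans r₃∣S₂ (divides (M (p * p)) (M-* (p * p) p)))
                                (λ { refl → ¬prime∣M∧geom pp p≢2 (λ ps → prime∣prime⇒≡ ps pp) p₁ r₁∣Mp r₂∣S₁ })
                                (λ { refl → ¬prime∣M∧geom pp p≢2 (only-prime∣p*p pp) p₁
                                                           (∣-trans r₁∣Mp (M-mono-∣ {p} (m∣m*n p))) r₃∣S₂ })
                                (λ { refl → ¬prime∣M∧geom pp p≢2 (only-prime∣p*p pp) p₂ r₂∣Mpp r₃∣S₂ })
                                in-ab
  where
  r₂∣Mpp : r₂ ∣ M (p * p)
  r₂∣Mpp = ∣-trans r₂∣S₁ (divides (M p) (M-* p p))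

¬primeDivisorsIn-M8 : ∀ {a b} → ¬ PrimeDivisorsIn (M 8) a b
¬primeDivisorsIn-M8 = three-primes⇒¬primeDivisorsIn
  (from-yes (prime? 3)) (from-yes (3 ∣? M 8)) (from-yes (prime? 5)) (from-yes (5 ∣? M 8))
  (from-yes (prime? 17)) (from-yes (17 ∣? M 8)) (λ ()) (λ ()) (λ ())

¬primeDivisorsIn-M12 : ∀ {a b} → ¬ PrimeDivisorsIn (M 12) a b
¬primeDivisorsIn-M12 = three-primes⇒¬primeDivisorsIn
  (from-yes (prime? 3)) (from-yes (3 ∣? M 12)) (from-yes (prime? 5)) (from-yes (5 ∣? M 12))
  (from-yes (prime? 7)) (from-yes (7 ∣? M 12)) (λ ()) (λ ()) (λ ())

¬primeDivisorsIn-M18 : ∀ {a b} → ¬ PrimeDivisorsIn (M 18) a b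
¬primeDivisorsIn-M18 = three-primes⇒¬primeDivisorsIn
  (from-yes (prime? 3)) (from-yes (3 ∣? M 18)) (from-yes (prime? 7)) (from-yes (7 ∣? M 18))
  (from-yes (prime? 73)) (from-yes (73 ∣? M 18)) (λ ()) (λ ()) (λ ())

data SmallFactorShape (n : ℕ) : Set where
  is-prime  : Prime n → SmallFactorShape n
  is-square : ∀ {p} → Prime p → n ≡ p * p → SmallFactorShape n
  has-pq    : ∀ {p q} → Prime p → Prime q → p ≢ q → p * q ∣ n → SmallFactorShape n
  has-cube  : ∀ {p} → Prime p → p * p * p ∣ n → SmallFactorShape n

smallFactorShape : ∀ n → 2 ≤ n → SmallFactorShape n
smallFactorShape n 2≤n with ∃primeFactor 2≤n
... | p , pp , divides m n≡m*p = by-cofactor m n≡m*p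
  where
  by-second-cofactor : ∀ k → n ≡ k * p * p → SmallFactorShape n
  by-second-cofactor 0 refl = ⊥-elim (<⇒≱ 2≤n z≤n)
  by-second-cofactor 1 n≡ = is-square pp (trans n≡ (cong (_* p) (+-identityʳ p)))
  by-second-cofactor k@(suc (suc _)) n≡ with ∃primeFactor {k} (s≤s (s≤s z≤n))
  ... | s , ps , s∣k with s ≟ p
  ...   | yes refl = has-cube pp (∣-trans (*-monoʳ-∣ (p * p) s∣k) (∣-reflexive (sym (trans n≡ (regroup k p)))))
    where
    regroup : ∀ k p → k * p * p ≡ p * p * k
    regroup = solve-∀
  ...   | no s≢p = has-pq pp ps (≢-sym s≢p) (∣-trans (*-monoʳ-∣ p s∣k) (divides p (trans n≡ (regroup k p))))
    where
    regroup : ∀ k p → k * p * p ≡ p * (p * k)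
    regroup = solve-∀
  by-cofactor : ∀ m → n ≡ m * p → SmallFactorShape n
  by-cofactor 0 refl = ⊥-elim (<⇒≱ 2≤n z≤n)
  by-cofactor 1 n≡ = is-prime (subst Prime (sym (trans n≡ (+-identityʳ p))) pp)
  by-cofactor m@(suc (suc _)) n≡ with ∃primeFactor {m} (s≤s (s≤s z≤n))
  ... | q , pq , divides k m≡k*q with q ≟ p
  ...   | yes refl = by-second-cofactor k (trans n≡ (cong (_* p) m≡k*q))
  ...   | no q≢p = has-pq pp pq (≢-sym q≢p)
                     (∣-trans (*-monoʳ-∣ p (divides k m≡k*q)) (∣-reflexive (sym (trans n≡ (*-comm m p)))))

Admissible : ℕ → Set
Admissible n = (n ≡ 4) ⊎ (n ≡ 6) ⊎ (∃[ p₁ ] (Prime p₁ × p₁ ≢ 2 × ((n ≡ p₁) ⊎ (n ≡ p₁ * p₁))))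

module _ {n a b : ℕ} (in-ab : PrimeDivisorsIn (M n) a b) where

  private
    in-divisor : ∀ {d} → d ∣ n → PrimeDivisorsIn (M d) a b
    in-divisor d∣n = primeDivisorsIn-∣ (M-mono-∣ d∣n) in-ab

  ¬pq∣n : ∀ {p q} → Prime p → Prime q → p ≢ q → 5 ≤ q → ¬ p * q ∣ n
  ¬pq∣n pp pq p≢q 5≤q pq∣n = ¬primeDivisorsIn-M[p*q] pp pq p≢q 5≤q (in-divisor pq∣n)

  pq∣n⇒6∣n : ∀ {p q} → Prime p → Prime q → p ≢ q → p * q ∣ n → 6 ∣ n
  pq∣n⇒6∣n {p} {q} pp pq p≢q pq∣n with q ≟ 2 | q ≟ 3
  ... | no q≢2 | no q≢3 = ⊥-elim (¬pq∣n pp pq p≢q (prime≥5 pq q≢2 q≢3) pq∣n)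
  ... | yes refl | _ with p ≟ 3
  ...   | yes refl = pq∣n
  ...   | no p≢3 = ⊥-elim (¬pq∣n pq pp (≢-sym p≢q) (prime≥5 pp p≢q p≢3) (subst (_∣ n) (*-comm p q) pq∣n))
  pq∣n⇒6∣n {p} {q} pp pq p≢q pq∣n | no _ | yes refl with p ≟ 2
  ...   | yes refl = pq∣n
  ...   | no p≢2 = ⊥-elim (¬pq∣n pq pp (≢-sym p≢q) (prime≥5 pp p≢2 p≢q) (subst (_∣ n) (*-comm p q) pq∣n))

  6∣n⇒n≡6 : 1 ≤ n → 6 ∣ n → n ≡ 6
  6∣n⇒n≡6 1≤n (divides c n≡c*6) = by-cofactor c n≡c*6
    where
    by-factor : ∀ s → Prime s → 6 * s ∣ n → ⊥
    by-factor s ps 6s∣n with s ≟ 2 | s ≟ 3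
    ... | yes refl | _ = ¬primeDivisorsIn-M12 (in-divisor 6s∣n)
    ... | no _ | yes refl = ¬primeDivisorsIn-M18 (in-divisor 6s∣n)
    ... | no s≢2 | no s≢3 =
      ¬pq∣n prime[2] ps (≢-sym s≢2) (prime≥5 ps s≢2 s≢3) (∣-trans (*-monoˡ-∣ s (divides {2} {6} 3 refl)) 6s∣n)
    by-cofactor : ∀ c → n ≡ c * 6 → n ≡ 6
    by-cofactor 0 refl = ⊥-elim (<⇒≱ 1≤n z≤n)
    by-cofactor 1 n≡ = n≡
    by-cofactor c@(suc (suc _)) n≡ with ∃primeFactor {c} (s≤s (s≤s z≤n))
    ... | s , ps , s∣c =
      ⊥-elim (by-factor s ps (∣-trans (*-monoʳ-∣ 6 s∣c) (∣-reflexive (sym (trans n≡ (*-comm c 6))))))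

  p*p*p∤n : ∀ {p} → Prime p → ¬ p * p * p ∣ n
  p*p*p∤n {p} pp ppp∣n with p ≟ 2
  ... | yes refl = ¬primeDivisorsIn-M8 (in-divisor ppp∣n)
  ... | no p≢2 = ¬primeDivisorsIn-M[p*p*p] pp p≢2 (in-divisor ppp∣n)

module Two = TwoPrimeDivisors

admissible : ∀ {n} → 1 ≤ n → TwoPrimeDivisors (M n) → Admissible n
admissible {1} _ two = ⊥-elim (prime≢1 (Two.prime-a two) (∣1⇒≡1 (Two.a∣m two)))
admissible {n@(suc (suc _))} 1≤n two with smallFactorShape n (s≤s (s≤s z≤n))
... | is-prime pn with n ≟ 2
...   | yes refl =
  ⊥-elim (Two.a≢b two (trans (≡3 (Two.prime-a two) (Two.a∣m two)) (sym (≡3 (Two.prime-b two) (Two.b∣m two)))))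
  where
  ≡3 : ∀ {r} → Prime r → r ∣ 3 → r ≡ 3
  ≡3 pr r∣3 = prime∣prime⇒≡ pr (from-yes (prime? 3)) r∣3
...   | no n≢2 = inj₂ (inj₂ (n , pn , n≢2 , inj₁ refl))
admissible {n@(suc (suc _))} 1≤n two | is-square {p} pp n≡p*p with p ≟ 2
...   | yes refl = inj₁ n≡p*p
...   | no p≢2 = inj₂ (inj₂ (p , pp , p≢2 , inj₂ n≡p*p))
admissible {n@(suc (suc _))} 1≤n two | has-pq pp pq p≢q pq∣n =
  inj₂ (inj₁ (6∣n⇒n≡6 (Two.in-ab two) 1≤n (pq∣n⇒6∣n (Two.in-ab two) pp pq p≢q pq∣n)))
admissible {n@(suc (suc _))} 1≤n two | has-cube pp ppp∣n = ⊥-elim (p*p*p∤n (Two.in-ab two) pp ppp∣n)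

theorem2 : (n : ℕ) → 0 < n → ω (M n) ≡ 2 →
    ((n ≡ 4) ⊎ (n ≡ 6) ⊎ (∃[ p₁ ] (Prime p₁ × p₁ ≢ 2 × ((n ≡ p₁) ⊎ (n ≡ p₁ * p₁)))))
    × ((p₁ : ℕ) → Prime p₁ → p₁ ≢ 2 → n ≡ p₁ * p₁ →
        ∃[ q ] ∃[ t ] (Prime q × 0 < t × M n ≡ M p₁ * q ^ t))
    × ((p₁ : ℕ) → Prime p₁ → p₁ ≢ 2 → n ≡ p₁ →
        ∃[ p ] ∃[ q ] ∃[ s ] ∃[ t ] ∃[ l₁ ] ∃[ l₂ ]
          (Prime p × Prime q × p ≢ q × p % 2 ≡ 1 × q % 2 ≡ 1
          × 0 < s × 0 < t × gcd s t ≡ 1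
          × M n ≡ p ^ s * q ^ t
          × p ≡ 2 * l₁ * p₁ + 1 × q ≡ 2 * l₂ * p₁ + 1
          × 0 < l₁ × 0 < l₂ × l₁ ≢ l₂
          × ((l₁ % 4 ≡ 0) ⊎ ((l₁ + p₁) % 4 ≡ 0))
          × ((l₂ % 4 ≡ 0) ⊎ ((l₂ + p₁) % 4 ≡ 0))))
theorem2 n 0<n ω≡2 =
  admissible 0<n two ,
  (λ p₁ pp₁ p₁≢2 n≡p₁² → M[p*p]≡M[p]*q^t pp₁ p₁≢2 n≡p₁² (Two.in-ab two)) ,
  (λ p₁ pp₁ p₁≢2 n≡p₁ → M[p]≡p^s*q^t pp₁ p₁≢2 n≡p₁ two)
  where
  two : TwoPrimeDivisors (M n)
  two = ω≡2⇒twoPrimeDivisors (M≥1 0<n) ω≡2
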